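{- Let $Y'\in\overline{\mathcal{Y}}$ be such that its pointer $\varepsilon$ is a visible vertex. Then $Y'\in\mathcal{Y}$.
   Context: Fix finite sets $\pi$ (ports), $\Sigma,\Delta$ (labels), with $m\notin\Sigma$, $m,l,r\notin\pi$. A graph has an at most countable vertex set, edges $\{u:a,v:b\}$ (unordered, $a,b$ ports) with each vertex–port pair in at most one edge, partial vertex and edge labels, and is connected. Pointed graphs modulo are isomorphism classes of pointed graphs under renamings preserving edges, ports, labels and pointer; the disk $X^r$ of a pointed graph modulo $X$ is the pointed graph modulo of the subgraph induced by vertices at distance $\le r+1$ from the pointer, with labels kept only on vertices at distance $\le r$ and edges between them. Let $\mathcal{X}'=\mathcal{X}_{\Sigma\cup\{m\},\Delta,\pi\cup\{m,l,r\}}$. $T$ is the infinite rooted binary tree, all vertices labelled $m$, each vertex linked through port $l$ (resp. $r$) to port $m$ of its left (resp. right) child. Each pointed graph modulo with ports $\pi$ and labels $\Sigma,\Delta$ is identified with the element of $\mathcal{X}'$ obtained by attaching to each vertex $v$ a copy of $T$ whose root's port $m$ is linked to port $m$ of $v$; $\mathcal{Y}$ is the set of such graphs pointed at any vertex. A vertex of an element of $\mathcal{X}'$ is invisible if it is labelled $m$, and visible otherwise. $\overline{\mathcal{Y}}$ is the set of $Y'\in\mathcal{X}'$ such that for every $r$ there is $Y\in\mathcal{Y}$ with $Y^r=Y'^r$. -}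

module Defs where

open import Data.Nat using (ℕ; _≤_; suc; zero)
open import Data.Maybe using (Maybe; just; nothing; map)
open import Data.Product using (Σ; _×_; _,_; proj₁; proj₂; map₁)
open import Data.List using (List; []; _∷_)
open import Relation.Binary.PropositionalEquality using (_≡_; _≢_)

-- An edge {u:a , v:b} is represented by  nbr u a ≡ just (v , b)
-- (and symmetrically nbr v b ≡ just (u , a)); since nbr is a function,
-- each vertex–port pair lies in at most one edge.
-- Labels are partial (Maybe); edge labels are stored at both ends of
-- the edge and required to agree (see WellFormed).

record PGraph (Lv Le P : Set) : Set₁ where
  field
    V    : Set
    nbr  : V → P → Maybe (V × P)
    vlab : V → Maybe Lv
    elab : V → P → Maybe Le
    ptr  : V

open PGraph public

module _ {Lv Le P : Set} (G : PGraph Lv Le P) where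

  data Path : ℕ → V G → V G → Set where
    here : ∀ {u} → Path 0 u u
    step : ∀ {n u v w a b} → nbr G u a ≡ just (v , b) → Path n v w → Path (suc n) u w

  Within : ℕ → V G → Set
  Within k v = Σ ℕ λ n → n ≤ k × Path n (ptr G) v

  record WellFormed : Set where
    field
      nbr-sym   : ∀ u a v b → nbr G u a ≡ just (v , b) → nbr G v b ≡ just (u , a)
      nbr-noself : ∀ u a → nbr G u a ≢ just (u , a)
      elab-none : ∀ u a → nbr G u a ≡ nothing → elab G u a ≡ nothing
      elab-sym  : ∀ u a v b → nbr G u a ≡ just (v , b) → elab G v b ≡ elab G u a

  Countable : Set
  Countable = Σ (V G → ℕ) λ e → ∀ x y → e x ≡ e y → x ≡ y

  Connected : Set
  Connected = ∀ v → Σ ℕ λ n → Path n (ptr G) v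

  IsGraph : Set
  IsGraph = WellFormed × Countable × Connected

record Iso {Lv Le P : Set} (X Y : PGraph Lv Le P) : Set where
  field
    to        : V X → V Y
    from      : V Y → V X
    from-to   : ∀ u → from (to u) ≡ u
    to-from   : ∀ v → to (from v) ≡ v
    ptr-pres  : to (ptr X) ≡ ptr Y
    nbr-pres  : ∀ u a → nbr Y (to u) a ≡ map (map₁ to) (nbr X u a)
    vlab-pres : ∀ u → vlab Y (to u) ≡ vlab X u
    elab-pres : ∀ u a → elab Y (to u) a ≡ elab X u a

-- Equality of disks  X^r = Y^r  (as pointed graphs modulo):
-- an isomorphism between the subgraphs induced by the vertices at
-- distance ≤ r+1 from the pointers, respecting vertex labels on vertices
-- at distance ≤ r and edge labels on edges between such vertices.

record DiskEq {Lv Le P : Set} (r : ℕ) (X Y : PGraph Lv Le P) : Set where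
  field
    to        : V X → V Y
    from      : V Y → V X
    ptr-pres  : to (ptr X) ≡ ptr Y
    to-in     : ∀ u → Within X (suc r) u → Within Y (suc r) (to u)
    from-in   : ∀ v → Within Y (suc r) v → Within X (suc r) (from v)
    from-to   : ∀ u → Within X (suc r) u → from (to u) ≡ u
    to-from   : ∀ v → Within Y (suc r) v → to (from v) ≡ v
    edge-pres : ∀ u u' a b → Within X (suc r) u → Within X (suc r) u' →
                (nbr X u a ≡ just (u' , b) → nbr Y (to u) a ≡ just (to u' , b)) ×
                (nbr Y (to u) a ≡ just (to u' , b) → nbr X u a ≡ just (u' , b))
    vlab-pres : ∀ u → Within X r u → vlab Y (to u) ≡ vlab X u
    elab-pres : ∀ u u' a b → Within X r u → Within X r u' →
                nbr X u a ≡ just (u' , b) → elab Y (to u) a ≡ elab X u a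

data Port' (π : Set) : Set where
  old : π → Port' π
  pm pl pr : Port' π

data Lab' (Σl : Set) : Set where
  oldL : Σl → Lab' Σl
  mL   : Lab' Σl

-- Vertices: node v (original vertices) and tnode v xs, the vertex of the
-- tree attached to v at address xs (xs = [] is the root; L ∷ xs is the
-- left child of xs, R ∷ xs its right child).

data Dir : Set where
  L R : Dir

data AV (W : Set) : Set where
  node  : W → AV W
  tnode : W → List Dir → AV W

module _ {Σl Δ π : Set} (G : PGraph Σl Δ π) where

  attachNbr : AV (V G) → Port' π → Maybe (AV (V G) × Port' π)
  attachNbr (node v) (old a) = map (λ wb → node (proj₁ wb) , old (proj₂ wb)) (nbr G v a)
  attachNbr (node v) pm = just (tnode v [] , pm)
  attachNbr (node v) pl = nothing
  attachNbr (node v) pr = nothing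
  attachNbr (tnode v xs) (old a) = nothing
  attachNbr (tnode v []) pm = just (node v , pm)
  attachNbr (tnode v (L ∷ xs)) pm = just (tnode v xs , pl)
  attachNbr (tnode v (R ∷ xs)) pm = just (tnode v xs , pr)
  attachNbr (tnode v xs) pl = just (tnode v (L ∷ xs) , pm)
  attachNbr (tnode v xs) pr = just (tnode v (R ∷ xs) , pm)

  attachVlab : AV (V G) → Maybe (Lab' Σl)
  attachVlab (node v) = map oldL (vlab G v)
  attachVlab (tnode v xs) = just mL

  attachElab : AV (V G) → Port' π → Maybe Δ
  attachElab (node v) (old a) = elab G v a
  attachElab _ _ = nothing

  attach : AV (V G) → PGraph (Lab' Σl) Δ (Port' π)
  attach w = record
    { V = AV (V G) ; nbr = attachNbr ; vlab = attachVlab ; elab = attachElab ; ptr = w }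

module _ {Σl Δ π : Set} where

  InY : PGraph (Lab' Σl) Δ (Port' π) → Set₁
  InY Y' = Σ (PGraph Σl Δ π) λ G → IsGraph G × Σ (AV (V G)) λ w → Iso (attach G w) Y'

  InYbar : PGraph (Lab' Σl) Δ (Port' π) → Set₁
  InYbar Y' = ∀ (r : ℕ) → Σ (PGraph Σl Δ π) λ G → IsGraph G ×
                Σ (AV (V G)) λ w → DiskEq r (attach G w) Y'

  Visible : (Y : PGraph (Lab' Σl) Δ (Port' π)) → V Y → Set
  Visible Y v = vlab Y v ≢ just mL

-- Every vertex u of Y' lies at some finite distance n from the pointer,
-- so the disk of radius n+1 of Y' contains u together with its neighbours.
-- Since Y' ∈ 𝒴̄ this disk is also a disk of some attached graph  attach G w ,
-- where the neighbourhood of every vertex is known explicitly.  Hence Y'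
-- satisfies, at every vertex, the local axioms of attached graphs
-- (LocalAxioms): visible vertices are joined to visible vertices through
-- π-ports, carry the root of a tree on port m and nothing on ports l, r;
-- invisible vertices have no π-edges, no edge labels, and l/r-children
-- joined through port m.  Conversely (reconstruction), a connected, countable,
-- well-formed graph satisfying the local axioms with a visible pointer is
-- isomorphic to  attach G ε  where G is its subgraph of visible vertices:
-- every invisible vertex is the vertex at a unique tree address below a
-- unique visible vertex.
module Submission where

open import Defs
open import Data.Nat using (ℕ; suc; zero; _+_; _≤_; z≤n; s≤s)
open import Data.Nat.Properties using (≤-trans; m≤m+n; +-suc; ≤-refl; n≤1+n)
open import Data.Fin using (Fin)
open import Data.Bool using (Bool; true; false; T)
open import Data.Bool.Properties using (T-irrelevant)
open import Data.Maybe using (Maybe; just; nothing; map)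
open import Data.Maybe.Properties using (just-injective)
open import Data.Product using (Σ; _×_; _,_; proj₁; proj₂; map₁)
open import Data.Product.Properties using (,-injective)
open import Data.List using (List; []; _∷_)
open import Data.Empty using (⊥-elim)
open import Relation.Nullary using (¬_; Dec; yes; no)
open import Relation.Nullary.Decidable using (T?)
open import Relation.Binary.PropositionalEquality
open import Function using (_∘′_)

module PathOps {Lv Le P : Set} (G : PGraph Lv Le P) where

  snoc : ∀ {n u v w a b} → Path G n u v → nbr G v a ≡ just (w , b) → Path G (suc n) u w
  snoc here e = step e here
  snoc (step e' p) e = step e' (snoc p e)

  append : ∀ {n m u v w} → Path G n u v → Path G m v w → Path G (n + m) u w
  append here q = q
  append (step e p) q = step e (append p q)

-- Visibility, as a proof-irrelevant predicate (needed to form the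
-- subgraph of visible vertices as a Σ-type).

visibleLabel : ∀ {S : Set} → Maybe (Lab' S) → Bool
visibleLabel (just mL) = false
visibleLabel (just (oldL _)) = true
visibleLabel nothing = true

IsVisible : ∀ {S D Q : Set} (Y : PGraph (Lab' S) D Q) → V Y → Set
IsVisible Y u = T (visibleLabel (vlab Y u))

Visible⇒IsVisible : ∀ {S D P : Set} (Y : PGraph (Lab' S) D (Port' P)) {u : V Y} →
                    Visible Y u → IsVisible Y u
Visible⇒IsVisible Y {u} vis with vlab Y u
... | nothing = _
... | just (oldL _) = _
... | just mL = vis refl

invisible⇒¬IsVisible : ∀ {S D Q : Set} (Y : PGraph (Lab' S) D Q) {u : V Y} →
                       vlab Y u ≡ just mL → ¬ IsVisible Y u
invisible⇒¬IsVisible Y {u} e vis with vlab Y u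
invisible⇒¬IsVisible Y refl () | just mL

lifted-visible : ∀ {S : Set} (l : Maybe S) → T (visibleLabel (map oldL l))
lifted-visible nothing = _
lifted-visible (just _) = _

module AttachedStructure {Σl Δ π : Set} (G : PGraph Σl Δ π) where

  visible⇒node : ∀ z → T (visibleLabel (attachVlab G z)) → Σ (V G) λ v → z ≡ node v
  visible⇒node (node v) _ = v , refl
  visible⇒node (tnode v xs) ()

  invisible⇒tnode : ∀ z → attachVlab G z ≡ just mL →
                    Σ (V G) λ v → Σ (List Dir) λ xs → z ≡ tnode v xs
  invisible⇒tnode (node v) e with vlab G v
  invisible⇒tnode (node v) () | just _
  invisible⇒tnode (node v) () | nothing
  invisible⇒tnode (tnode v xs) _ = v , xs , refl

  node-π-edge : ∀ v {a y b} → attachNbr G (node v) (old a) ≡ just (y , b) →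
                T (visibleLabel (attachVlab G y)) × Σ π λ b' → b ≡ old b'
  node-π-edge v {a} e with nbr G v a
  node-π-edge v refl | just (w , b') = lifted-visible (vlab G w) , b' , refl

module DiskTransport {S D Q : Set} {r : ℕ} {X Y : PGraph S D Q} (Dk : DiskEq r X Y) where
  open DiskEq Dk

  from-ptr : from (ptr Y) ≡ ptr X
  from-ptr = trans (cong from (sym ptr-pres)) (from-to (ptr X) (0 , z≤n , here))

  edge-back : ∀ {s v a b} → Within Y (suc r) s → Within Y (suc r) v →
              nbr Y s a ≡ just (v , b) → nbr X (from s) a ≡ just (from v , b)
  edge-back {s} {v} {a} {b} ws wv e =
    proj₂ (edge-pres (from s) (from v) a b (from-in s ws) (from-in v wv))
      (begin
        nbr Y (to (from s)) a   ≡⟨ cong (λ z → nbr Y z a) (to-from s ws) ⟩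
        nbr Y s a               ≡⟨ e ⟩
        just (v , b)            ≡⟨ cong (λ z → just (z , b)) (sym (to-from v wv)) ⟩
        just (to (from v) , b)  ∎)
    where open ≡-Reasoning

  path-back-from : ∀ j k {s t} → Path Y j (ptr Y) s → Path Y k s t → j + k ≤ suc r →
                   Path X k (from s) (from t)
  path-back-from j zero ps here le = here
  path-back-from j (suc k) ps (step e q) le =
    step (edge-back (j , ≤-trans (m≤m+n j (suc k)) le , ps)
                    (suc j , ≤-trans (m≤m+n (suc j) k) le' , ps')
                    e)
         (path-back-from (suc j) k ps' q le')
    where
      ps' = PathOps.snoc Y ps e
      le' : suc j + k ≤ suc r
      le' = subst (_≤ suc r) (+-suc j k) le

  path-back : ∀ {n u} → Path Y n (ptr Y) u → n ≤ suc r → Path X n (ptr X) (from u)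
  path-back {n} {u} p le = subst (λ z → Path X n z (from u)) from-ptr (path-back-from 0 n here p le)

  label-forth : ∀ {k x} → Path X k (ptr X) x → k ≤ r → vlab Y (to x) ≡ vlab X x
  label-forth {k} {x} p le = vlab-pres x (k , le , p)

  edge-forth : ∀ {k x x' a b} → Path X k (ptr X) x → k ≤ r → nbr X x a ≡ just (x' , b) →
               nbr Y (to x) a ≡ just (to x' , b)
  edge-forth {k} {x} {x'} {a} {b} p le e =
    proj₁ (edge-pres x x' a b (k , ≤-trans le (n≤1+n r) , p)
                              (suc k , s≤s le , PathOps.snoc X p e)) e

module _ {S D P : Set} (Y : PGraph (Lab' S) D (Port' P)) where

  TreeChild : V Y → Port' P → Set
  TreeChild u a = Σ (V Y) λ c → nbr Y u a ≡ just (c , pm) × vlab Y c ≡ just mL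

  record LocalAxioms (u : V Y) : Set where
    field
      visible-π-edge : IsVisible Y u → ∀ {a u' b} → nbr Y u (old a) ≡ just (u' , b) →
                       IsVisible Y u' × Σ P λ b' → b ≡ old b'
      visible-root   : IsVisible Y u → TreeChild u pm
      visible-no-l   : IsVisible Y u → nbr Y u pl ≡ nothing
      visible-no-r   : IsVisible Y u → nbr Y u pr ≡ nothing
      invisible-no-π : vlab Y u ≡ just mL → ∀ a → nbr Y u (old a) ≡ nothing
      invisible-l    : vlab Y u ≡ just mL → TreeChild u pl
      invisible-r    : vlab Y u ≡ just mL → TreeChild u pr
      invisible-unlabelled : vlab Y u ≡ just mL → ∀ {a u' b} →
                             nbr Y u a ≡ just (u' , b) → elab Y u a ≡ nothing

-- If the disk of radius n+1 of Y equals that of an attached graph, the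
-- local axioms hold at every vertex u at distance n from the pointer of Y:
-- u and its neighbours lie in the disk of radius n+1 of attach G w, where
-- the axioms are read off the definition of attachNbr.

module LocalAxiomsFromDisk {S D P : Set} (Y : PGraph (Lab' S) D (Port' P))
    (G : PGraph S D P) (w : AV (V G)) {n : ℕ} (Dk : DiskEq (suc n) (attach G w) Y)
    {u : V Y} (pu : Path Y n (ptr Y) u) where

  X : PGraph (Lab' S) D (Port' P)
  X = attach G w

  open DiskEq Dk
  open DiskTransport Dk
  open AttachedStructure G

  n≤2+n : n ≤ suc (suc n)
  n≤2+n = ≤-trans (n≤1+n n) (n≤1+n (suc n))

  x : AV (V G)
  x = from u

  px : Path X n (ptr X) x
  px = path-back pu n≤2+n

  within-u : Within Y (suc (suc n)) u
  within-u = n , n≤2+n , pu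

  within-nbr : ∀ {u' a b} → nbr Y u a ≡ just (u' , b) → Within Y (suc (suc n)) u'
  within-nbr e = suc n , n≤1+n (suc n) , PathOps.snoc Y pu e

  to-x : to x ≡ u
  to-x = to-from u within-u

  label-u : vlab Y u ≡ attachVlab G x
  label-u = trans (cong (vlab Y) (sym to-x)) (label-forth px (n≤1+n n))

  label-nbr : ∀ {u' a b} → nbr Y u a ≡ just (u' , b) → vlab Y u' ≡ attachVlab G (from u')
  label-nbr {u'} e = trans (cong (vlab Y) (sym (to-from u' (within-nbr e))))
                           (label-forth (path-back (PathOps.snoc Y pu e) (n≤1+n (suc n))) ≤-refl)

  edge-back-u : ∀ {a u' b} → nbr Y u a ≡ just (u' , b) → attachNbr G x a ≡ just (from u' , b)
  edge-back-u e = edge-back within-u (within-nbr e) e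

  tree-child-forth : ∀ {a y} → attachNbr G x a ≡ just (y , pm) → attachVlab G y ≡ just mL →
                     TreeChild Y u a
  tree-child-forth {a} {y} e inv =
    to y , trans (cong (λ z → nbr Y z a) (sym to-x)) (edge-forth px (n≤1+n n) e)
         , trans (label-forth (PathOps.snoc X px e) ≤-refl) inv

  no-edge-forth : ∀ {a} → attachNbr G x a ≡ nothing → nbr Y u a ≡ nothing
  no-edge-forth {a} e with nbr Y u a in e'
  ... | nothing = refl
  ... | just _ with trans (sym (edge-back-u e')) e
  ... | ()

  x-node : IsVisible Y u → Σ (V G) λ v → x ≡ node v
  x-node vis = visible⇒node x (subst (T ∘′ visibleLabel) label-u vis)

  x-tnode : vlab Y u ≡ just mL → Σ (V G) λ v → Σ (List Dir) λ xs → x ≡ tnode v xs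
  x-tnode inv = invisible⇒tnode x (trans (sym label-u) inv)

  local-axioms : LocalAxioms Y u
  local-axioms = record
    { visible-π-edge = visible-π-edge
    ; visible-root = λ vis → let (v , ex) = x-node vis in
        tree-child-forth (cong (λ z → attachNbr G z pm) ex) refl
    ; visible-no-l = λ vis → no-edge-forth (cong (λ z → attachNbr G z pl) (proj₂ (x-node vis)))
    ; visible-no-r = λ vis → no-edge-forth (cong (λ z → attachNbr G z pr) (proj₂ (x-node vis)))
    ; invisible-no-π = λ inv a → let (v , xs , ex) = x-tnode inv in
        no-edge-forth (cong (λ z → attachNbr G z (old a)) ex)
    ; invisible-l = λ inv → let (v , xs , ex) = x-tnode inv in
        tree-child-forth (cong (λ z → attachNbr G z pl) ex) refl
    ; invisible-r = λ inv → let (v , xs , ex) = x-tnode inv in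
        tree-child-forth (cong (λ z → attachNbr G z pr) ex) refl
    ; invisible-unlabelled = invisible-unlabelled
    }
    where
      visible-π-edge : IsVisible Y u → ∀ {a u' b} → nbr Y u (old a) ≡ just (u' , b) →
                       IsVisible Y u' × Σ P λ b' → b ≡ old b'
      visible-π-edge vis {a} {u'} {b} e =
        let (v , ex) = x-node vis
            (vis' , b≡old) = node-π-edge v (subst (λ z → attachNbr G z (old a) ≡ just (from u' , b)) ex
                                                  (edge-back-u e))
        in subst (T ∘′ visibleLabel) (sym (label-nbr e)) vis' , b≡old

      invisible-unlabelled : vlab Y u ≡ just mL → ∀ {a u' b} → nbr Y u a ≡ just (u' , b) →
                             elab Y u a ≡ nothing
      invisible-unlabelled inv {a} {u'} {b} e =
        let (v , xs , ex) = x-tnode inv in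
        trans (cong (λ z → elab Y z a) (sym to-x))
              (trans (elab-pres x (from u') a b (n , n≤1+n n , px)
                                (suc n , ≤-refl , path-back (PathOps.snoc Y pu e) (n≤1+n (suc n)))
                                (edge-back-u e))
                     (cong (λ z → attachElab G z a) ex))

-- In the closure of 𝒴 the local axioms hold everywhere: for a vertex at
-- distance n from the pointer use an approximation of radius n+1.
closure⇒local-axioms : ∀ {S D P : Set} (Y : PGraph (Lab' S) D (Port' P)) →
                       Connected Y → InYbar Y → ∀ u → LocalAxioms Y u
closure⇒local-axioms Y cn yb u =
  let (n , pu) = cn u
      (G , _ , w , Dk) = yb (suc n)
  in LocalAxiomsFromDisk.local-axioms Y G w Dk pu

-- G is the subgraph of its visible vertices, joined
-- by the π-edges of Y.  The tree vertex at address xs below v is found by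
-- following port m of v and then the ports l/r dictated by xs; this embeds
-- attach G (node ε) into Y, and the embedding is an isomorphism.

module Reconstruction {S D P : Set} (Y : PGraph (Lab' S) D (Port' P))
    (wf : WellFormed Y) (cnt : Countable Y) (cn : Connected Y)
    (axioms : ∀ u → LocalAxioms Y u) (ptr-visible : Visible Y (ptr Y)) where

  open WellFormed wf
  module Ax (u : V Y) = LocalAxioms (axioms u)

  VG : Set
  VG = Σ (V Y) (IsVisible Y)

  VG-≡ : ∀ {u u'} {vis : IsVisible Y u} {vis' : IsVisible Y u'} →
         u ≡ u' → _≡_ {A = VG} (u , vis) (u' , vis')
  VG-≡ {vis = vis} {vis'} refl = cong (_ ,_) (T-irrelevant vis vis')

  restrict : (u : V Y) → Dec (IsVisible Y u) → P → Maybe (VG × P)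
  restrict u (yes vis) b = just ((u , vis) , b)
  restrict u (no _) b = nothing

  restrict-visible : ∀ u d (vis : IsVisible Y u) b → restrict u d b ≡ just ((u , vis) , b)
  restrict-visible u (yes vis') vis b = cong (λ z → just ((u , z) , b)) (T-irrelevant vis' vis)
  restrict-visible u (no ¬vis) vis b = ⊥-elim (¬vis vis)

  restrict-inv : ∀ u d b {v b'} → restrict u d b ≡ just (v , b') → u ≡ proj₁ v × b ≡ b'
  restrict-inv u (yes vis) b refl = refl , refl

  visible? : ∀ u → Dec (IsVisible Y u)
  visible? u = T? (visibleLabel (vlab Y u))

  visibleEdge : Maybe (V Y × Port' P) → Maybe (VG × P)
  visibleEdge (just (u , old b)) = restrict u (visible? u) b
  visibleEdge _ = nothing

  visibleEdge-inv : ∀ m {v b} → visibleEdge m ≡ just (v , b) → m ≡ just (proj₁ v , old b)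
  visibleEdge-inv (just (u , old b)) e with restrict-inv u _ b e
  ... | refl , refl = refl

  unlift : Maybe (Lab' S) → Maybe S
  unlift (just (oldL s)) = just s
  unlift _ = nothing

  unlift-visible : ∀ l → T (visibleLabel l) → l ≡ map oldL (unlift l)
  unlift-visible nothing _ = refl
  unlift-visible (just (oldL _)) _ = refl

  root : VG
  root = ptr Y , Visible⇒IsVisible Y ptr-visible

  G : PGraph S D P
  G = record { V = VG ; nbr = λ v a → visibleEdge (nbr Y (proj₁ v) (old a))
             ; vlab = λ v → unlift (vlab Y (proj₁ v))
             ; elab = λ v a → elab Y (proj₁ v) (old a) ; ptr = root }

  visible-edge : ∀ u {a u' b'} (vis' : IsVisible Y u') → nbr Y u (old a) ≡ just (u' , old b') →
                 visibleEdge (nbr Y u (old a)) ≡ just ((u' , vis') , b')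
  visible-edge u {u' = u'} {b'} vis' e =
    trans (cong visibleEdge e) (restrict-visible u' (visible? u') vis' b')

  -- the vertex behind port a of u (u itself if the port is free)
  follow : V Y → Port' P → V Y
  follow u a with nbr Y u a
  ... | just (c , _) = c
  ... | nothing = u

  follow-child : ∀ {u a} → TreeChild Y u a →
                 nbr Y u a ≡ just (follow u a , pm) × vlab Y (follow u a) ≡ just mL
  follow-child {u} {a} (c , e , inv) rewrite e = refl , inv

  treeVertex : VG → List Dir → V Y
  treeVertex (u , _) [] = follow u pm
  treeVertex v (L ∷ xs) = follow (treeVertex v xs) pl
  treeVertex v (R ∷ xs) = follow (treeVertex v xs) pr

  parent : VG → List Dir → V Y
  parent (u , _) [] = u
  parent v (_ ∷ xs) = treeVertex v xs

  parentPort : List Dir → Port' P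
  parentPort [] = pm
  parentPort (L ∷ _) = pl
  parentPort (R ∷ _) = pr

  treeVertex-child : ∀ v xs → nbr Y (parent v xs) (parentPort xs) ≡ just (treeVertex v xs , pm) ×
                              vlab Y (treeVertex v xs) ≡ just mL
  treeVertex-child (u , vis) [] = follow-child (Ax.visible-root u vis)
  treeVertex-child v (L ∷ xs) = follow-child (Ax.invisible-l _ (proj₂ (treeVertex-child v xs)))
  treeVertex-child v (R ∷ xs) = follow-child (Ax.invisible-r _ (proj₂ (treeVertex-child v xs)))

  treeVertex-invisible : ∀ v xs → vlab Y (treeVertex v xs) ≡ just mL
  treeVertex-invisible v xs = proj₂ (treeVertex-child v xs)

  tree-down : ∀ v xs → nbr Y (parent v xs) (parentPort xs) ≡ just (treeVertex v xs , pm)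
  tree-down v xs = proj₁ (treeVertex-child v xs)

  tree-up : ∀ v xs → nbr Y (treeVertex v xs) pm ≡ just (parent v xs , parentPort xs)
  tree-up v xs = nbr-sym _ _ _ _ (tree-down v xs)

  invisible-elab : ∀ {u} → vlab Y u ≡ just mL → ∀ a → elab Y u a ≡ nothing
  invisible-elab {u} inv a with nbr Y u a in e
  ... | nothing = elab-none u a e
  ... | just _ = Ax.invisible-unlabelled u inv e

  embed : AV VG → V Y
  embed (node v) = proj₁ v
  embed (tnode v xs) = treeVertex v xs

  embed-nbr : ∀ z a → nbr Y (embed z) a ≡ map (map₁ embed) (attachNbr G z a)
  embed-nbr (node (u , vis)) (old a) with nbr Y u (old a) in e
  ... | nothing = refl
  ... | just (u' , b) with Ax.visible-π-edge u vis e
  ... | vis' , b' , refl =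
    cong (λ m → map (map₁ embed) (map (λ wb → node (proj₁ wb) , old (proj₂ wb)) m))
         (sym (restrict-visible u' (visible? u') vis' b'))
  embed-nbr (node (u , vis)) pm = tree-down (u , vis) []
  embed-nbr (node (u , vis)) pl = Ax.visible-no-l u vis
  embed-nbr (node (u , vis)) pr = Ax.visible-no-r u vis
  embed-nbr (tnode v xs) (old a) = Ax.invisible-no-π _ (treeVertex-invisible v xs) a
  embed-nbr (tnode v []) pm = tree-up v []
  embed-nbr (tnode v (L ∷ xs)) pm = tree-up v (L ∷ xs)
  embed-nbr (tnode v (R ∷ xs)) pm = tree-up v (R ∷ xs)
  embed-nbr (tnode v xs) pl = tree-down v (L ∷ xs)
  embed-nbr (tnode v xs) pr = tree-down v (R ∷ xs)

  embed-vlab : ∀ z → vlab Y (embed z) ≡ attachVlab G z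
  embed-vlab (node (u , vis)) = unlift-visible (vlab Y u) vis
  embed-vlab (tnode v xs) = treeVertex-invisible v xs

  embed-elab : ∀ z a → elab Y (embed z) a ≡ attachElab G z a
  embed-elab (node v) (old a) = refl
  embed-elab (node v) pm = trans (sym (elab-sym _ _ _ _ (tree-down v [])))
                                 (invisible-elab (treeVertex-invisible v []) pm)
  embed-elab (node (u , vis)) pl = elab-none _ _ (Ax.visible-no-l u vis)
  embed-elab (node (u , vis)) pr = elab-none _ _ (Ax.visible-no-r u vis)
  embed-elab (tnode v xs) a = invisible-elab (treeVertex-invisible v xs) a

  embed-edge-lift : ∀ z {a v b} → nbr Y (embed z) a ≡ just (v , b) →
                    Σ (AV VG) λ y → attachNbr G z a ≡ just (y , b) × embed y ≡ v
  embed-edge-lift z {a} e with attachNbr G z a | embed-nbr z a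
  ... | nothing | e' with trans (sym e) e'
  ...   | ()
  embed-edge-lift z {a} e | just (y , b') | e' with trans (sym e) e'
  ... | refl = y , refl , refl

  owner : AV VG → VG
  owner (node v) = v
  owner (tnode v _) = v

  owner-step : ∀ z {a y b} → attachNbr G z a ≡ just (y , b) → Σ ℕ λ m → Path G m (owner z) (owner y)
  owner-step (node v) {old a} e with nbr G v a in e'
  owner-step (node v) {old a} refl | just (w , b') = 1 , step e' here
  owner-step (node v) {pm} refl = 0 , here
  owner-step (tnode v []) {pm} refl = 0 , here
  owner-step (tnode v (L ∷ xs)) {pm} refl = 0 , here
  owner-step (tnode v (R ∷ xs)) {pm} refl = 0 , here
  owner-step (tnode v xs) {pl} refl = 0 , here
  owner-step (tnode v xs) {pr} refl = 0 , here

  lift-path : ∀ {n} z {t} → Path Y n (embed z) t →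
              Σ (AV VG) λ y → embed y ≡ t × Σ ℕ λ m → Path G m (owner z) (owner y)
  lift-path z here = z , refl , 0 , here
  lift-path z (step e p) with embed-edge-lift z e
  ... | y , e' , refl with lift-path y p
  ... | t , et , m , q = t , et , _ , PathOps.append G (proj₂ (owner-step z e')) q

  preimage : ∀ u → Σ (AV VG) λ z → embed z ≡ u × Σ ℕ λ m → Path G m root (owner z)
  preimage u = lift-path (node root) (proj₂ (cn u))

  G-connected : Connected G
  G-connected (u , vis) with preimage u
  ... | node _ , refl , m , p = m , subst (Path G m root) (VG-≡ refl) p
  ... | tnode v xs , refl , _ = ⊥-elim (invisible⇒¬IsVisible Y (treeVertex-invisible v xs) vis)

  -- a tree vertex determines its parent and the port leading to it, hence its address
  mutual
    treeVertex-injective : ∀ v xs v' xs' → treeVertex v xs ≡ treeVertex v' xs' →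
                           _≡_ {A = AV VG} (tnode v xs) (tnode v' xs')
    treeVertex-injective v xs v' xs' h =
      let (same-parent , same-port) =
            ,-injective (just-injective (trans (sym (tree-up v xs))
                                        (trans (cong (λ t → nbr Y t pm) h) (tree-up v' xs'))))
      in parent-injective v xs v' xs' same-parent same-port

    parent-injective : ∀ v xs v' xs' → parent v xs ≡ parent v' xs' → parentPort xs ≡ parentPort xs' →
                       _≡_ {A = AV VG} (tnode v xs) (tnode v' xs')
    parent-injective v [] v' [] h _ = cong (λ z → tnode z []) (VG-≡ h)
    parent-injective v (L ∷ xs) v' (L ∷ ys) h _ with treeVertex-injective v xs v' ys h
    ... | refl = refl
    parent-injective v (R ∷ xs) v' (R ∷ ys) h _ with treeVertex-injective v xs v' ys h
    ... | refl = refl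
    parent-injective v [] v' (L ∷ _) _ ()
    parent-injective v [] v' (R ∷ _) _ ()
    parent-injective v (L ∷ _) v' [] _ ()
    parent-injective v (L ∷ _) v' (R ∷ _) _ ()
    parent-injective v (R ∷ _) v' [] _ ()
    parent-injective v (R ∷ _) v' (L ∷ _) _ ()

  embed-injective : ∀ z y → embed z ≡ embed y → z ≡ y
  embed-injective (node _) (node _) h = cong node (VG-≡ h)
  embed-injective (node (u , vis)) (tnode v xs) refl =
    ⊥-elim (invisible⇒¬IsVisible Y (treeVertex-invisible v xs) vis)
  embed-injective (tnode v xs) (node (u , vis)) refl =
    ⊥-elim (invisible⇒¬IsVisible Y (treeVertex-invisible v xs) vis)
  embed-injective (tnode v xs) (tnode v' xs') h = treeVertex-injective v xs v' xs' h

  G-well-formed : WellFormed G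
  G-well-formed = record
    { nbr-sym = λ u a v b e →
        visible-edge (proj₁ v) (proj₂ u) (nbr-sym _ _ _ _ (visibleEdge-inv _ e))
    ; nbr-noself = λ u a e → nbr-noself (proj₁ u) (old a) (visibleEdge-inv _ e)
    ; elab-none = no-edge-no-label
    ; elab-sym = λ u a v b e → elab-sym _ _ _ _ (visibleEdge-inv _ e)
    }
    where
      no-edge-no-label : ∀ (u : VG) a → visibleEdge (nbr Y (proj₁ u) (old a)) ≡ nothing →
                         elab Y (proj₁ u) (old a) ≡ nothing
      no-edge-no-label (u , vis) a h with nbr Y u (old a) in e
      ... | nothing = elab-none u (old a) e
      ... | just (u' , b) with Ax.visible-π-edge u vis e
      ... | vis' , b' , refl with trans (sym (restrict-visible u' (visible? u') vis' b')) h
      ... | ()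

  G-countable : Countable G
  G-countable = (λ v → proj₁ cnt (proj₁ v)) , λ v v' h → VG-≡ (proj₂ cnt _ _ h)

  embedding-iso : Iso (attach G (node root)) Y
  embedding-iso = record
    { to = embed
    ; from = λ u → proj₁ (preimage u)
    ; from-to = λ z → embed-injective _ _ (proj₁ (proj₂ (preimage (embed z))))
    ; to-from = λ u → proj₁ (proj₂ (preimage u))
    ; ptr-pres = refl
    ; nbr-pres = embed-nbr
    ; vlab-pres = embed-vlab
    ; elab-pres = embed-elab
    }

  in-𝒴 : InY Y
  in-𝒴 = G , (G-well-formed , G-countable , G-connected) , node root , embedding-iso

proposition1 : (p s d : ℕ) (Y' : PGraph (Lab' (Fin s)) (Fin d) (Port' (Fin p))) →
               IsGraph Y' → InYbar Y' → Visible Y' (ptr Y') → InY Y'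
proposition1 p s d Y' (wf , cnt , cn) yb ptr-visible =
  Reconstruction.in-𝒴 Y' wf cnt cn (closure⇒local-axioms Y' cn yb) ptr-visible
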